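{- Let $a>1$ and $b>1$ be relatively prime integers. For $1 \le i \le m$, let $p_i$ be one of the $m$ distinct prime divisors of $a$. Let $p_i^{g_i} \| b^{n_i} \pm 1$, where $n_i$ is the least positive integer for which there exists a positive integer $k$ such that $\vert b^{n_i} - k p_i \vert = 1$, and $\pm$ is read as the sign that maximizes $g_i$. Write $\sigma = \sum_i g_i \log(p_i)/\log(a)$. Then, if $a^x \mid b^y \pm 1$, where this $\pm$ sign is independent of the signs chosen in the definition of the $g_i$, we must have $a^x \mid a^{\sigma} y$.
   Context: Here $p^g \| n$ means $p^g$ divides $n$ but $p^{g+1}$ does not. The divisibility $a^x \mid a^{\sigma} y$ is understood in the sense that $y$ is divisible by $\prod_i p_i^{x\alpha_i - g_i} = a^{x-\sigma}$ (where $a=\prod_i p_i^{\alpha_i}$), with factors $p_i^{x\alpha_i-g_i}$ possibly fractional when $x\alpha_i<g_i$. -}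

module Defs where

open import Data.Nat using (ℕ; suc; _^_; _*_; _≤_)
open import Data.Nat.Divisibility using (_∣_)
open import Data.Integer as ℤ using (ℤ; +_; ∣_∣)
open import Data.Product using (Σ; _×_)
open import Relation.Nullary using (¬_)
open import Relation.Binary.PropositionalEquality using (_≡_)

_^_∥_ : ℕ → ℕ → ℕ → Set
p ^ g ∥ n = (p ^ g ∣ n) × ¬ (p ^ suc g ∣ n)

NearMultiple : (b p n : ℕ) → Set
NearMultiple b p n = Σ ℕ λ k → 1 ≤ k × ∣ + (b ^ n) ℤ.- + (k * p) ∣ ≡ 1

LeastNear : (b p n : ℕ) → Set
LeastNear b p n = 1 ≤ n × NearMultiple b p n × (∀ m → 1 ≤ m → NearMultiple b p m → n ≤ m)

{-# OPTIONS --safe #-}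
module Submission where

-- Put c = b ^ n and G = g₋ ⊔ g₊. Taking the sign δ = ±1 that realises the maximum, c = δ + p ^ G w
-- with p ∤ w; moreover G ≥ 1, and G ≥ 2 if p = 2 (c is then odd, so 4 divides c − 1 or c + 1).
-- Suppose p ^ (G + K) ∣ b ^ y − s with s = ±1. Since b ^ n ≡ ±1 (mod p), writing y = q n + r gives
-- p ∣ b ^ r ∓ 1, and the minimality of n forces r = 0; thus (δ + p ^ G w) ^ q ≡ s (mod p ^ (G + K)).
-- The sign s = −δ ^ q would give p ^ G ∣ 2, which the bounds on G exclude. For s = δ ^ q we lift the
-- exponent: by the binomial theorem (δ + p ^ G w) ^ q ≡ δ ^ q + q δ ^ (q − 1) p ^ G w (mod p ^ (G + 1)),
-- whence p ∣ q, and (δ + p ^ G w) ^ p = δ ^ p + p ^ (G + 1) w′ with p ∤ w′ (the bounds on G make the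
-- quadratic term vanish modulo p ^ (G + 2)). Induction on K gives p ^ K ∣ q, hence p ^ K ∣ y.

open import Data.Empty using (⊥-elim)
open import Data.Integer as ℤ
  using (ℤ; NonZero; +_; -[1+_]; _+_; _-_; -_; _*_; _^_; 0ℤ; 1ℤ; -1ℤ)
open import Data.Integer.Properties
  using (pos-*; pos-+; abs-*; neg-involutive; *-assoc; *-identityʳ; *-zeroˡ; *-comm; ^-distribˡ-+-*; ^-*-assoc)
open import Data.Integer.Divisibility.Signed as ℤ∣ using (divides) renaming (_∣_ to _∣ℤ_)
open import Data.Integer.Tactic.RingSolver using (solve-∀)
open import Data.Nat as ℕ using (ℕ; zero; suc; _≤_; _<_; s≤s; z≤n; _∸_; _⊔_)
open import Data.Nat.Base using (nonTrivial⇒n>1; nonTrivial⇒≢1)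
open import Data.Nat.Combinatorics using (_C_; nC1≡n; nCk+nC[k+1]≡[n+1]C[k+1])
open import Data.Nat.Coprimality using (Coprime)
open import Data.Nat.Divisibility as ℕ∣ using (_∣_; _∤_)
open import Data.Nat.DivMod using (_%_; _/_; m≡m%n+[m/n]*n; m%n<n)
open import Data.Nat.Primality using (Prime; euclidsLemma; prime⇒nonZero; prime⇒nonTrivial)
import Data.Nat.Properties as ℕₚ
import Data.Nat.Tactic.RingSolver as ℕ-Solver
open import Data.Product using (Σ; _×_; _,_)
open import Data.Sum using (_⊎_; inj₁; inj₂; [_,_]′) renaming (map to ⊎-map)
open import Relation.Binary.PropositionalEquality
open import Relation.Nullary using (¬_; yes; no)

open import Defs

prime≢1 : ∀ {p} → Prime p → p ≢ 1
prime≢1 p-prime = nonTrivial⇒≢1 {{prime⇒nonTrivial p-prime}}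

prime∣2⇒≡2 : ∀ {p} → Prime p → p ∣ 2 → p ≡ 2
prime∣2⇒≡2 {p} p-prime p∣2 = ℕₚ.≤-antisym (ℕ∣.∣⇒≤ p∣2) (nonTrivial⇒n>1 p {{prime⇒nonTrivial p-prime}})

prime∤⇒∤^ : ∀ {p b} → Prime p → p ∤ b → ∀ n → p ∤ b ℕ.^ n
prime∤⇒∤^ p-prime _ zero p∣1 = prime≢1 p-prime (ℕ∣.∣1⇒≡1 p∣1)
prime∤⇒∤^ {b = b} p-prime p∤b (suc n) p∣b^[1+n] with euclidsLemma b (b ℕ.^ n) p-prime p∣b^[1+n]
... | inj₁ p∣b   = p∤b p∣b
... | inj₂ p∣b^n = prime∤⇒∤^ p-prime p∤b n p∣b^n

1<⇒1≤^ : ∀ {b} → 1 < b → ∀ n → 1 ≤ b ℕ.^ n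
1<⇒1≤^ {suc b} _ n = ℕₚ.m^n>0 (suc b) n

^-monoʳ-∣ : ∀ p {m n} → m ≤ n → p ℕ.^ m ∣ p ℕ.^ n
^-monoʳ-∣ p {m} {n} m≤n = ℕ∣.divides (p ℕ.^ (n ∸ m)) (begin
  p ℕ.^ n                     ≡⟨ cong (p ℕ.^_) (ℕₚ.m+[n∸m]≡n m≤n) ⟨
  p ℕ.^ (m ℕ.+ (n ∸ m))       ≡⟨ ℕₚ.^-distribˡ-+-* p m (n ∸ m) ⟩
  p ℕ.^ m ℕ.* p ℕ.^ (n ∸ m)   ≡⟨ ℕₚ.*-comm (p ℕ.^ m) (p ℕ.^ (n ∸ m)) ⟩
  p ℕ.^ (n ∸ m) ℕ.* p ℕ.^ m   ∎)
  where open ≡-Reasoning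

^-monoˡ-∣ : ∀ {m n} → m ∣ n → ∀ k → m ℕ.^ k ∣ n ℕ.^ k
^-monoˡ-∣ m∣n zero    = ℕ∣.∣-refl
^-monoˡ-∣ m∣n (suc k) = ℕ∣.*-pres-∣ m∣n (^-monoˡ-∣ m∣n k)

∥-bound : ∀ {p g k m} → p ^ g ∥ m → p ℕ.^ k ∣ m → k ≤ g
∥-bound {p} {g} {k} (_ , p^[1+g]∤m) p^k∣m with k ℕ.≤? g
... | yes k≤g = k≤g
... | no  k≰g = ⊥-elim (p^[1+g]∤m (ℕ∣.∣-trans (^-monoʳ-∣ p (ℕₚ.≰⇒> k≰g)) p^k∣m))

∥-∣⇒1≤ : ∀ {p g m} → p ^ g ∥ m → p ∣ m → 1 ≤ g
∥-∣⇒1≤ {p} p^g∥m p∣m = ∥-bound p^g∥m (subst (_∣ _) (sym (ℕₚ.*-identityʳ p)) p∣m)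

odd⇒4∣∸1⊎4∣+1 : ∀ c → 2 ∤ c → 4 ∣ c ∸ 1 ⊎ 4 ∣ (c ℕ.+ 1)
odd⇒4∣∸1⊎4∣+1 0 2∤c = ⊥-elim (2∤c (ℕ∣._∣0 2))
odd⇒4∣∸1⊎4∣+1 1 _   = inj₁ (ℕ∣._∣0 4)
odd⇒4∣∸1⊎4∣+1 2 2∤c = ⊥-elim (2∤c ℕ∣.∣-refl)
odd⇒4∣∸1⊎4∣+1 3 _   = inj₂ ℕ∣.∣-refl
odd⇒4∣∸1⊎4∣+1 4 2∤c = ⊥-elim (2∤c (ℕ∣.divides 2 refl))
odd⇒4∣∸1⊎4∣+1 (suc (suc (suc (suc (suc c))))) 2∤c+5
  with odd⇒4∣∸1⊎4∣+1 (suc c) (λ 2∣c+1 → 2∤c+5 (ℕ∣.∣m∣n⇒∣m+n (ℕ∣.divides 2 refl) 2∣c+1))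
... | inj₁ 4∣c   = inj₁ (ℕ∣.∣m∣n⇒∣m+n (ℕ∣.∣-refl {4}) 4∣c)
... | inj₂ 4∣c+2 = inj₂ (ℕ∣.∣m∣n⇒∣m+n (ℕ∣.∣-refl {4}) 4∣c+2)

2*[1+n]C2≡[1+n]*n : ∀ n → 2 ℕ.* (suc n C 2) ≡ suc n ℕ.* n
2*[1+n]C2≡[1+n]*n zero    = refl
2*[1+n]C2≡[1+n]*n (suc n) = begin
  2 ℕ.* (suc (suc n) C 2)             ≡⟨ cong (2 ℕ.*_) (nCk+nC[k+1]≡[n+1]C[k+1] (suc n) 1) ⟨
  2 ℕ.* (suc n C 1 ℕ.+ suc n C 2)     ≡⟨ cong (λ c → 2 ℕ.* (c ℕ.+ suc n C 2)) (nC1≡n (suc n)) ⟩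
  2 ℕ.* (suc n ℕ.+ suc n C 2)         ≡⟨ ℕₚ.*-distribˡ-+ 2 (suc n) (suc n C 2) ⟩
  2 ℕ.* suc n ℕ.+ 2 ℕ.* (suc n C 2)   ≡⟨ cong (2 ℕ.* suc n ℕ.+_) (2*[1+n]C2≡[1+n]*n n) ⟩
  2 ℕ.* suc n ℕ.+ suc n ℕ.* n         ≡⟨ collect n ⟩
  suc (suc n) ℕ.* suc n               ∎
  where
  open ≡-Reasoning
  collect : ∀ n → 2 ℕ.* suc n ℕ.+ suc n ℕ.* n ≡ suc (suc n) ℕ.* suc n
  collect = ℕ-Solver.solve-∀

prime∣pC2 : ∀ {p} → Prime p → p ≢ 2 → p ∣ p C 2
prime∣pC2 {zero}  p-prime _   = ⊥-elim (ℕ.≢-nonZero⁻¹ 0 {{prime⇒nonZero p-prime}} refl)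
prime∣pC2 {suc n} p-prime p≢2
  with euclidsLemma 2 (suc n C 2) p-prime (subst (suc n ∣_) (sym (2*[1+n]C2≡[1+n]*n n)) (ℕ∣.m∣m*n n))
... | inj₁ p∣2   = ⊥-elim (p≢2 (prime∣2⇒≡2 p-prime p∣2))
... | inj₂ p∣pC2 = p∣pC2

pos-^ : ∀ m k → + (m ℕ.^ k) ≡ (+ m) ^ k
pos-^ m zero    = refl
pos-^ m (suc k) = trans (pos-* m (m ℕ.^ k)) (cong (+ m *_) (pos-^ m k))

^∣ᵤ⇒^∣ℤ : ∀ {p k X} → p ℕ.^ k ∣ ℤ.∣ X ∣ → (+ p) ^ k ∣ℤ X
^∣ᵤ⇒^∣ℤ {p} {k} p^k∣X = ℤ∣.∣ᵤ⇒∣ (subst (_∣ _) (cong ℤ.∣_∣ (pos-^ p k)) p^k∣X)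

^∣ℤ⇒^∣ᵤ : ∀ {p k X} → (+ p) ^ k ∣ℤ X → p ℕ.^ k ∣ ℤ.∣ X ∣
^∣ℤ⇒^∣ᵤ {p} {k} P^k∣X = subst (_∣ _) (cong ℤ.∣_∣ (sym (pos-^ p k))) (ℤ∣.∣⇒∣ᵤ P^k∣X)

m∣m^n : ∀ {m n} → 1 ≤ n → m ∣ℤ m ^ n
m∣m^n {m} {suc n} _ = ℤ∣.∣m⇒∣m*n (m ^ n) (ℤ∣.∣-refl {m})

m^n∣m^[n+o] : ∀ m n o → m ^ n ∣ℤ m ^ (n ℕ.+ o)
m^n∣m^[n+o] m n o = divides (m ^ o) (trans (^-distribˡ-+-* m n o) (*-comm (m ^ n) (m ^ o)))

∣m-n⇒∣m^k-n^k : ∀ {i m n} → i ∣ℤ m - n → ∀ k → i ∣ℤ m ^ k - n ^ k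
∣m-n⇒∣m^k-n^k {i} _ zero = divides 0ℤ (sym (*-zeroˡ i))
∣m-n⇒∣m^k-n^k {i} {m} {n} i∣m-n (suc k) =
  subst (i ∣ℤ_) (sym (telescope m n (m ^ k) (n ^ k)))
    (ℤ∣.∣m∣n⇒∣m+n (ℤ∣.∣n⇒∣m*n m (∣m-n⇒∣m^k-n^k i∣m-n k)) (ℤ∣.∣m⇒∣m*n (n ^ k) i∣m-n))
  where
  telescope : ∀ m n a b → m * a - n * b ≡ m * (a - b) + (m - n) * b
  telescope = solve-∀

m-[m-n]≡n : ∀ m n → m - (m - n) ≡ n
m-[m-n]≡n = solve-∀

prime^-nonZero : ∀ {p} → Prime p → ∀ k → NonZero ((+ p) ^ k)
prime^-nonZero {p} p-prime k = subst NonZero (pos-^ p k) (ℕₚ.m^n≢0 p k {{prime⇒nonZero p-prime}})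

prime∣*⇒∣⊎∣ : ∀ {p} → Prime p → ∀ {m n} → + p ∣ℤ m * n → + p ∣ℤ m ⊎ + p ∣ℤ n
prime∣*⇒∣⊎∣ p-prime {m} {n} p∣mn
  with euclidsLemma ℤ.∣ m ∣ ℤ.∣ n ∣ p-prime (subst (_ ∣_) (abs-* m n) (ℤ∣.∣⇒∣ᵤ p∣mn))
... | inj₁ p∣m = inj₁ (ℤ∣.∣ᵤ⇒∣ p∣m)
... | inj₂ p∣n = inj₂ (ℤ∣.∣ᵤ⇒∣ p∣n)

-- u = ±1, stated as an equation so that the ring solver can use it.
Unit : ℤ → Set
Unit u = u * u ≡ 1ℤ

∣∣≡1⇒±1 : ∀ u → ℤ.∣ u ∣ ≡ 1 → u ≡ 1ℤ ⊎ u ≡ -1ℤ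
∣∣≡1⇒±1 (+ .1)    refl = inj₁ refl
∣∣≡1⇒±1 -[1+ .0 ] refl = inj₂ refl

unit⇒±1 : ∀ {u} → Unit u → u ≡ 1ℤ ⊎ u ≡ -1ℤ
unit⇒±1 {u} uu = ∣∣≡1⇒±1 u (ℕₚ.m*n≡1⇒m≡1 ℤ.∣ u ∣ ℤ.∣ u ∣ (trans (sym (abs-* u u)) (cong ℤ.∣_∣ uu)))

∣∣≡1⇒unit : ∀ u → ℤ.∣ u ∣ ≡ 1 → Unit u
∣∣≡1⇒unit u ∣u∣≡1 with ∣∣≡1⇒±1 u ∣u∣≡1
... | inj₁ refl = refl
... | inj₂ refl = refl

unit⇒∣∣≡1 : ∀ {u} → Unit u → ℤ.∣ u ∣ ≡ 1
unit⇒∣∣≡1 {u} uu with unit⇒±1 {u} uu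
... | inj₁ refl = refl
... | inj₂ refl = refl

*-unit : ∀ {u v} → Unit u → Unit v → Unit (u * v)
*-unit {u} {v} uu vv = trans (rearrange u v) (cong₂ _*_ uu vv)
  where
  rearrange : ∀ u v → (u * v) * (u * v) ≡ (u * u) * (v * v)
  rearrange = solve-∀

^-unit : ∀ {u} → Unit u → ∀ k → Unit (u ^ k)
^-unit     uu zero    = refl
^-unit {u} uu (suc k) = *-unit {u} {u ^ k} uu (^-unit uu k)

unit-≡⊎≡- : ∀ {s u} → Unit s → Unit u → s ≡ u ⊎ s ≡ - u
unit-≡⊎≡- {s} {u} ss uu with unit⇒±1 {s} ss | unit⇒±1 {u} uu
... | inj₁ refl | inj₁ refl = inj₁ refl
... | inj₁ refl | inj₂ refl = inj₂ refl
... | inj₂ refl | inj₁ refl = inj₂ refl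
... | inj₂ refl | inj₂ refl = inj₁ refl

-- Lets the ring solver prove identities that only hold modulo a side equation x ≡ y.
+-*-defect : ∀ {x y} → x ≡ y → ∀ a b → a + b * (x - y) ≡ a
+-*-defect {x} refl a b = vanish a b x
  where
  vanish : ∀ a b x → a + b * (x - x) ≡ a
  vanish = solve-∀

∣m*u⇒∣m : ∀ {i m u} → Unit u → i ∣ℤ m * u → i ∣ℤ m
∣m*u⇒∣m {i} {m} {u} uu i∣mu = subst (i ∣ℤ_) m*u*u≡m (ℤ∣.∣m⇒∣m*n u i∣mu)
  where
  m*u*u≡m : m * u * u ≡ m
  m*u*u≡m = trans (*-assoc m u u) (trans (cong (m *_) uu) (*-identityʳ m))

∣m*u-n⇒∣m-n*u : ∀ {i m n u} → Unit u → i ∣ℤ m * u - n → i ∣ℤ m - n * u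
∣m*u-n⇒∣m-n*u {i} {m} {n} {u} uu i∣ = subst (i ∣ℤ_) shifted (ℤ∣.∣m⇒∣m*n u i∣)
  where
  expand : ∀ m n u → (m * u - n) * u ≡ (m - n * u) + m * (u * u - 1ℤ)
  expand = solve-∀
  shifted : (m * u - n) * u ≡ m - n * u
  shifted = trans (expand m n u) (+-*-defect uu (m - n * u) m)

binomial₂ : ∀ {δ} → Unit δ → ∀ d q → Σ ℤ λ R →
  (δ + d) ^ q ≡ δ ^ q * (1ℤ + + q * δ * d + + (q C 2) * (d * d)) + d * d * d * R
binomial₂ _ d zero = 0ℤ , initial d
  where
  initial : ∀ d → 1ℤ ≡ 1ℤ * (1ℤ + 0ℤ * 1ℤ * d + 0ℤ * (d * d)) + d * d * d * 0ℤ
  initial = solve-∀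
binomial₂ {δ} δδ d (suc q) with binomial₂ δδ d q
... | R , expansion = δ ^ q * T + (δ + d) * R , (begin
  (δ + d) ^ suc q
    ≡⟨ cong ((δ + d) *_) expansion ⟩
  (δ + d) * (δ ^ q * (1ℤ + + q * δ * d + T * (d * d)) + d * d * d * R)
    ≡⟨ step δ d (δ ^ q) R (+ q) T ⟩
  δ * δ ^ q * (1ℤ + + suc q * δ * d + (T + + q) * (d * d)) + d * d * d * R′ + - (δ ^ q * d) * (δ * δ - 1ℤ)
    ≡⟨ +-*-defect δδ _ (- (δ ^ q * d)) ⟩
  δ * δ ^ q * (1ℤ + + suc q * δ * d + (T + + q) * (d * d)) + d * d * d * R′
    ≡⟨ cong (λ c → δ * δ ^ q * (1ℤ + + suc q * δ * d + c * (d * d)) + d * d * d * R′) [qC2]+q≡[1+q]C2 ⟩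
  δ ^ suc q * (1ℤ + + suc q * δ * d + + (suc q C 2) * (d * d)) + d * d * d * R′ ∎)
  where
  open ≡-Reasoning
  T = + (q C 2)
  R′ = δ ^ q * T + (δ + d) * R
  step : ∀ δ d X R t T → (δ + d) * (X * (1ℤ + t * δ * d + T * (d * d)) + d * d * d * R)
       ≡ δ * X * (1ℤ + (1ℤ + t) * δ * d + (T + t) * (d * d)) + d * d * d * (X * T + (δ + d) * R)
         + - (X * d) * (δ * δ - 1ℤ)
  step = solve-∀
  [qC2]+q≡[1+q]C2 : T + + q ≡ + (suc q C 2)
  [qC2]+q≡[1+q]C2 = begin
    + (q C 2) + + q       ≡⟨ pos-+ (q C 2) q ⟨
    + (q C 2 ℕ.+ q)       ≡⟨ cong +_ (ℕₚ.+-comm (q C 2) q) ⟩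
    + (q ℕ.+ q C 2)       ≡⟨ cong (λ c → + (c ℕ.+ q C 2)) (nC1≡n q) ⟨
    + (q C 1 ℕ.+ q C 2)   ≡⟨ cong +_ (nCk+nC[k+1]≡[n+1]C[k+1] q 1) ⟩
    + (suc q C 2)         ∎

-- The condition on G under which, for c = δ + p ^ G w with δ = ±1 and p ∤ w,
-- the power c ^ p is again of this form with G replaced by suc G.
Liftable : ℕ → ℕ → Set
Liftable p G = 1 ≤ G × (p ≢ 2 ⊎ 2 ≤ G)

liftable-suc : ∀ {p G} → Liftable p G → Liftable p (suc G)
liftable-suc (_ , inj₁ p≢2) = s≤s z≤n , inj₁ p≢2
liftable-suc (_ , inj₂ 2≤G) = s≤s z≤n , inj₂ (ℕₚ.m≤n⇒m≤1+n 2≤G)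

liftable⇒p∣pC2*p^G : ∀ {p G} → Prime p → Liftable p (suc G) → p ∣ (p C 2) ℕ.* p ℕ.^ G
liftable⇒p∣pC2*p^G {p} {G} p-prime (_ , inj₁ p≢2) =
  ℕ∣.∣m⇒∣m*n (p ℕ.^ G) (prime∣pC2 p-prime p≢2)
liftable⇒p∣pC2*p^G {p} {suc G} p-prime (_ , inj₂ (s≤s (s≤s _))) =
  ℕ∣.∣n⇒∣m*n (p C 2) (ℕ∣.m∣m*n (p ℕ.^ G))

liftable⇒p^G∤2 : ∀ {p G} → Prime p → Liftable p G → p ℕ.^ G ∤ 2
liftable⇒p^G∤2 {p} {suc G} p-prime (_ , inj₁ p≢2) p^G∣2 =
  p≢2 (prime∣2⇒≡2 p-prime (ℕ∣.∣-trans (ℕ∣.m∣m*n (p ℕ.^ G)) p^G∣2))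
liftable⇒p^G∤2 {G = suc zero} _ (_ , inj₂ (s≤s ()))
liftable⇒p^G∤2 {p} {suc (suc G)} p-prime (_ , inj₂ _) p^G∣2 =
  prime≢1 p-prime (ℕ∣.∣1⇒≡1 (ℕ∣.*-cancelˡ-∣ p {{prime⇒nonZero p-prime}} p*p∣p*1))
  where
  p≡2 : p ≡ 2
  p≡2 = prime∣2⇒≡2 p-prime (ℕ∣.∣-trans (ℕ∣.m∣m*n (p ℕ.^ suc G)) p^G∣2)
  p*p∣p*1 : p ℕ.* p ∣ p ℕ.* 1
  p*p∣p*1 = ℕ∣.∣-trans (ℕ∣.*-monoʳ-∣ p (ℕ∣.m∣m*n (p ℕ.^ G)))
              (subst (p ℕ.^ suc (suc G) ∣_) (sym (trans (ℕₚ.*-identityʳ p) p≡2)) p^G∣2)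

^p-lift : ∀ {p G δ w} → Prime p → Liftable p G → Unit δ → ¬ + p ∣ℤ w →
  Σ ℤ λ w′ → (δ + (+ p) ^ G * w) ^ p ≡ δ ^ p + (+ p) ^ suc G * w′ × ¬ + p ∣ℤ w′
^p-lift {p} {suc G} {δ} {w} p-prime lift δδ p∤w
  with binomial₂ δδ ((+ p) ^ suc G * w) p | liftable⇒p∣pC2*p^G p-prime lift
... | R , expansion | ℕ∣.divides v pC2*p^G≡v*p = w′ , lifted , p∤w′
  where
  P = + p
  Y = P ^ G
  w₀ = δ ^ p * + v * w * w + Y * Y * w * w * w * R
  w′ = w * (δ ^ p * δ) + P * w₀
  pC2*Y≡v*P : + (p C 2) * Y ≡ + v * P
  pC2*Y≡v*P = begin
    + (p C 2) * Y             ≡⟨ cong (+ (p C 2) *_) (pos-^ p G) ⟨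
    + (p C 2) * + (p ℕ.^ G)   ≡⟨ pos-* (p C 2) (p ℕ.^ G) ⟨
    + ((p C 2) ℕ.* p ℕ.^ G)   ≡⟨ cong +_ pC2*p^G≡v*p ⟩
    + (v ℕ.* p)               ≡⟨ pos-* v p ⟩
    + v * P                   ∎
    where open ≡-Reasoning
  regroup : ∀ X δ P Y w T v R →
    X * (1ℤ + P * δ * (P * Y * w) + T * ((P * Y * w) * (P * Y * w))) + (P * Y * w) * (P * Y * w) * (P * Y * w) * R
    ≡ X + P * (P * Y) * (w * (X * δ) + P * (X * v * w * w + Y * Y * w * w * w * R))
      + X * P * P * Y * w * w * (T * Y - v * P)
  regroup = solve-∀
  lifted : (δ + P ^ suc G * w) ^ p ≡ δ ^ p + P ^ suc (suc G) * w′
  lifted = trans expansion (trans (regroup (δ ^ p) δ P Y w (+ (p C 2)) (+ v) R)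
             (+-*-defect pC2*Y≡v*P (δ ^ p + P ^ suc (suc G) * w′) (δ ^ p * P * P * Y * w * w)))
  p∤w′ : ¬ P ∣ℤ w′
  p∤w′ P∣w′ = p∤w (∣m*u⇒∣m (*-unit {δ ^ p} {δ} (^-unit δδ p) δδ)
                (ℤ∣.∣m+n∣n⇒∣m P∣w′ (ℤ∣.∣m⇒∣m*n w₀ (ℤ∣.∣-refl {P}))))

prime∣exponent : ∀ {p G δ w} → Prime p → Liftable p G → Unit δ → ¬ + p ∣ℤ w → ∀ q →
  (+ p) ^ suc G ∣ℤ (δ + (+ p) ^ G * w) ^ q - δ ^ q → p ∣ q
prime∣exponent {p} {suc G} {δ} {w} p-prime _ δδ p∤w q h with binomial₂ δδ ((+ p) ^ suc G * w) q
... | R , expansion =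
  [ ℤ∣.∣⇒∣ᵤ , (λ P∣w → ⊥-elim (p∤w P∣w)) ]′ (prime∣*⇒∣⊎∣ p-prime {+ q} {w} P∣qw)
  where
  P = + p
  Y = P ^ G
  Z₀ = Y * w * w * (δ ^ q * + (q C 2) + P * Y * w * R)
  regroup : ∀ X δ P Y w q T R →
    X * (1ℤ + q * δ * (P * Y * w) + T * ((P * Y * w) * (P * Y * w))) + (P * Y * w) * (P * Y * w) * (P * Y * w) * R - X
    ≡ (P * Y) * (q * w * (X * δ) + P * (Y * w * w * (X * T + P * Y * w * R)))
  regroup = solve-∀
  difference : (δ + P ^ suc G * w) ^ q - δ ^ q ≡ (P * Y) * (+ q * w * (δ ^ q * δ) + P * Z₀)
  difference = trans (cong (_- δ ^ q) expansion) (regroup (δ ^ q) δ P Y w (+ q) (+ (q C 2)) R)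
  P∣Z : P ∣ℤ + q * w * (δ ^ q * δ) + P * Z₀
  P∣Z = ℤ∣.*-cancelˡ-∣ (P * Y) {{prime^-nonZero p-prime (suc G)}}
          (subst₂ _∣ℤ_ (*-comm P (P * Y)) difference h)
  P∣qw : P ∣ℤ + q * w
  P∣qw = ∣m*u⇒∣m {P} {+ q * w} {δ ^ q * δ} (*-unit {δ ^ q} {δ} (^-unit δδ q) δδ)
           (ℤ∣.∣m+n∣n⇒∣m {P} {+ q * w * (δ ^ q * δ)} {P * Z₀} P∣Z (ℤ∣.∣m⇒∣m*n Z₀ (ℤ∣.∣-refl {P})))

lifting-the-exponent : ∀ {p G δ w} → Prime p → Liftable p G → Unit δ → ¬ + p ∣ℤ w → ∀ K q →
  (+ p) ^ (G ℕ.+ K) ∣ℤ (δ + (+ p) ^ G * w) ^ q - δ ^ q → p ℕ.^ K ∣ q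
lifting-the-exponent _ _ _ _ zero q _ = ℕ∣.1∣ q
lifting-the-exponent {p} {G} {δ} {w} p-prime lift δδ p∤w (suc K) q h with ^p-lift p-prime lift δδ p∤w
... | w′ , lifted , p∤w′ =
  subst (p ℕ.^ suc K ∣_) (sym q≡p*q′)
    (ℕ∣.*-monoʳ-∣ p (lifting-the-exponent p-prime (liftable-suc lift) (^-unit δδ p) p∤w′ K q′ h′))
  where
  P = + p
  h₁ : P ^ (suc G ℕ.+ K) ∣ℤ (δ + P ^ G * w) ^ q - δ ^ q
  h₁ = subst (λ e → P ^ e ∣ℤ (δ + P ^ G * w) ^ q - δ ^ q) (ℕₚ.+-suc G K) h
  p∣q : p ∣ q
  p∣q = prime∣exponent p-prime lift δδ p∤w q (ℤ∣.∣-trans (m^n∣m^[n+o] P (suc G) K) h₁)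
  q′ = ℕ∣._∣_.quotient p∣q
  q≡p*q′ : q ≡ p ℕ.* q′
  q≡p*q′ = ℕ∣.m∣n⇒n≡m*quotient p∣q
  reindex : ∀ x → x ^ q ≡ (x ^ p) ^ q′
  reindex x = trans (cong (x ^_) q≡p*q′) (sym (^-*-assoc x p q′))
  h′ : P ^ (suc G ℕ.+ K) ∣ℤ (δ ^ p + P ^ suc G * w′) ^ q′ - (δ ^ p) ^ q′
  h′ = subst (P ^ (suc G ℕ.+ K) ∣ℤ_)
         (cong₂ _-_ (trans (reindex (δ + P ^ G * w)) (cong (_^ q′) lifted)) (reindex δ)) h₁

¬∣c^q+δ^q : ∀ {p G δ} → Prime p → Liftable p G → Unit δ → ∀ w q →
  ¬ (+ p) ^ G ∣ℤ (δ + (+ p) ^ G * w) ^ q + δ ^ q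
¬∣c^q+δ^q {p} {G} {δ} p-prime lift δδ w q h =
  liftable⇒p^G∤2 p-prime lift (^∣ℤ⇒^∣ᵤ {p} {G} (∣m*u⇒∣m {P^G} {+ 2} {δ ^ q} (^-unit δδ q) P^G∣2δ^q))
  where
  P^G = (+ p) ^ G
  c = δ + P^G * w
  P^G∣c-δ : P^G ∣ℤ c - δ
  P^G∣c-δ = divides w (cancel δ P^G w)
    where
    cancel : ∀ δ Y w → δ + Y * w - δ ≡ w * Y
    cancel = solve-∀
  P^G∣2δ^q : P^G ∣ℤ + 2 * δ ^ q
  P^G∣2δ^q = subst (P^G ∣ℤ_) (difference (c ^ q) (δ ^ q)) (ℤ∣.∣m∣n⇒∣m-n h (∣m-n⇒∣m^k-n^k P^G∣c-δ q))
    where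
    difference : ∀ a b → a + b - (a - b) ≡ + 2 * b
    difference = solve-∀

lifting-the-exponent± : ∀ {p G δ w s} → Prime p → Liftable p G → Unit δ → ¬ + p ∣ℤ w → Unit s →
  ∀ K q → (+ p) ^ (G ℕ.+ K) ∣ℤ (δ + (+ p) ^ G * w) ^ q - s → p ℕ.^ K ∣ q
lifting-the-exponent± {p} {G} {δ} {w} {s} p-prime lift δδ p∤w ss K q h
  with unit-≡⊎≡- {s} {δ ^ q} ss (^-unit δδ q)
... | inj₁ refl = lifting-the-exponent p-prime lift δδ p∤w K q h
... | inj₂ refl = ⊥-elim (¬∣c^q+δ^q p-prime lift δδ w q (ℤ∣.∣-trans (m^n∣m^[n+o] (+ p) G K)
                    (subst (_ ∣ℤ_) (cong (λ e → (δ + (+ p) ^ G * w) ^ q + e) (neg-involutive (δ ^ q))) h)))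

∥-decompose : ∀ {p g X δ} → p ^ g ∥ ℤ.∣ X - δ ∣ → Σ ℤ λ w → X ≡ δ + (+ p) ^ g * w × ¬ + p ∣ℤ w
∥-decompose {p} {g} {X} {δ} (p^g∣X-δ , p^[1+g]∤X-δ) = w , X≡δ+P^g*w , p∤w
  where
  P^g∣X-δ = ^∣ᵤ⇒^∣ℤ {p} {g} p^g∣X-δ
  w = ℤ∣._∣_.quotient P^g∣X-δ
  X-δ≡w*P^g : X - δ ≡ w * (+ p) ^ g
  X-δ≡w*P^g = ℤ∣._∣_.equality P^g∣X-δ
  recentre : ∀ X δ → X ≡ δ + (X - δ)
  recentre = solve-∀
  X≡δ+P^g*w : X ≡ δ + (+ p) ^ g * w
  X≡δ+P^g*w = trans (recentre X δ) (cong (λ e → δ + e) (trans X-δ≡w*P^g (*-comm w ((+ p) ^ g))))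
  p∤w : ¬ + p ∣ℤ w
  p∤w (divides w₂ w≡w₂*p) = p^[1+g]∤X-δ (^∣ℤ⇒^∣ᵤ {p} {suc g} (divides w₂ (begin
    X - δ                  ≡⟨ X-δ≡w*P^g ⟩
    w * (+ p) ^ g          ≡⟨ cong (_* (+ p) ^ g) w≡w₂*p ⟩
    w₂ * + p * (+ p) ^ g   ≡⟨ *-assoc w₂ (+ p) ((+ p) ^ g) ⟩
    w₂ * (+ p) ^ suc g     ∎)))
    where open ≡-Reasoning

factor-at-max : ∀ {p g₋ g₊ c} → 1 ≤ c → p ^ g₋ ∥ (c ∸ 1) → p ^ g₊ ∥ (c ℕ.+ 1) →
  Σ ℤ λ δ → Σ ℤ λ w → Unit δ × + c ≡ δ + (+ p) ^ (g₋ ⊔ g₊) * w × ¬ + p ∣ℤ w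
factor-at-max {p} {g₋} {g₊} {suc c} _ h₋ h₊ with ℕₚ.≤-total g₊ g₋
... | inj₁ g₊≤g₋ rewrite ℕₚ.m≥n⇒m⊔n≡m g₊≤g₋ =
  let w , c≡ , p∤w = ∥-decompose {p} {g₋} {+ suc c} {1ℤ} h₋ in 1ℤ , w , refl , c≡ , p∤w
... | inj₂ g₋≤g₊ rewrite ℕₚ.m≤n⇒m⊔n≡n g₋≤g₊ =
  let w , c≡ , p∤w = ∥-decompose {p} {g₊} {+ suc c} { -1ℤ} h₊ in -1ℤ , w , refl , c≡ , p∤w

1≤g₋⊔g₊ : ∀ {p c η g₋ g₊} → 1 ≤ c → Unit η → + p ∣ℤ + c - η →
  p ^ g₋ ∥ (c ∸ 1) → p ^ g₊ ∥ (c ℕ.+ 1) → 1 ≤ g₋ ⊔ g₊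
1≤g₋⊔g₊ {p} {suc c} {η} {g₋} {g₊} _ ηη p∣c-η h₋ h₊ with unit⇒±1 {η} ηη
... | inj₁ refl = ℕₚ.m≤n⇒m≤n⊔o g₊ (∥-∣⇒1≤ h₋ (ℤ∣.∣⇒∣ᵤ p∣c-η))
... | inj₂ refl = ℕₚ.m≤n⇒m≤o⊔n g₋ (∥-∣⇒1≤ h₊ (ℤ∣.∣⇒∣ᵤ p∣c-η))

p≢2⊎2≤g₋⊔g₊ : ∀ {p c g₋ g₊} → p ∤ c → p ^ g₋ ∥ (c ∸ 1) → p ^ g₊ ∥ (c ℕ.+ 1) →
  p ≢ 2 ⊎ 2 ≤ g₋ ⊔ g₊
p≢2⊎2≤g₋⊔g₊ {p} {c} {g₋} {g₊} p∤c h₋ h₊ with p ℕ.≟ 2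
... | no p≢2 = inj₁ p≢2
... | yes refl with odd⇒4∣∸1⊎4∣+1 c p∤c
...   | inj₁ 4∣c∸1 = inj₂ (ℕₚ.m≤n⇒m≤n⊔o g₊ (∥-bound h₋ 4∣c∸1))
...   | inj₂ 4∣c+1 = inj₂ (ℕₚ.m≤n⇒m≤o⊔n g₋ (∥-bound h₊ 4∣c+1))

nearMultiple⇒∣ : ∀ {b p n} → NearMultiple b p n → Σ ℤ λ η → Unit η × + p ∣ℤ (+ b) ^ n - η
nearMultiple⇒∣ {b} {p} {n} (k , _ , ∣X∣≡1) = X , ∣∣≡1⇒unit X ∣X∣≡1 , divides (+ k) B^n-X≡k*p
  where
  X = + (b ℕ.^ n) - + (k ℕ.* p)
  B^n-X≡k*p : (+ b) ^ n - X ≡ + k * + p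
  B^n-X≡k*p = trans (cong (_- X) (sym (pos-^ b n))) (trans (m-[m-n]≡n (+ (b ℕ.^ n)) (+ (k ℕ.* p))) (pos-* k p))

∣⇒nearMultiple : ∀ {b p ε} → 1 < b → Unit ε → ∀ r → + p ∣ℤ (+ b) ^ suc r - ε → NearMultiple b p (suc r)
∣⇒nearMultiple {b} {p} {ε} 1<b εε r p∣ =
  near (b ℕ.^ suc r) 2≤b^[1+r] (subst (λ B → + p ∣ℤ B - ε) (sym (pos-^ b (suc r))) p∣)
  where
  2≤b^[1+r] : 2 ≤ b ℕ.^ suc r
  2≤b^[1+r] = ℕₚ.≤-trans 1<b (ℕₚ.m≤m*n b (b ℕ.^ r) {{ℕ.>-nonZero (1<⇒1≤^ 1<b r)}})
  positive : ∀ M → 2 ≤ M → Σ ℕ λ N → + M - ε ≡ + suc N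
  positive (suc zero) (s≤s ())
  positive (suc (suc m)) _ with unit⇒±1 {ε} εε
  ... | inj₁ refl = m , refl
  ... | inj₂ refl = suc m ℕ.+ 1 , refl
  near : ∀ M → 2 ≤ M → + p ∣ℤ + M - ε → Σ ℕ λ k → 1 ≤ k × ℤ.∣ + M - + (k ℕ.* p) ∣ ≡ 1
  near M 2≤M p∣M-ε with positive M 2≤M
  ... | N , M-ε≡1+N with subst (λ i → p ∣ ℤ.∣ i ∣) M-ε≡1+N (ℤ∣.∣⇒∣ᵤ p∣M-ε)
  ...   | ℕ∣.divides (suc k) 1+N≡k*p = suc k , s≤s z≤n , (begin
    ℤ.∣ + M - + (suc k ℕ.* p) ∣   ≡⟨ cong (λ i → ℤ.∣ + M - i ∣) (trans (cong +_ (sym 1+N≡k*p)) (sym M-ε≡1+N)) ⟩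
    ℤ.∣ + M - (+ M - ε) ∣         ≡⟨ cong ℤ.∣_∣ (m-[m-n]≡n (+ M) ε) ⟩
    ℤ.∣ ε ∣                       ≡⟨ unit⇒∣∣≡1 {ε} εε ⟩
    1                             ∎)
    where open ≡-Reasoning

leastNear⇒∣ : ∀ {b p n s} → 1 < b → LeastNear b p n → Unit s → ∀ y → + p ∣ℤ (+ b) ^ y - s → n ∣ y
leastNear⇒∣ {b} {p} {suc n} {s} 1<b (s≤s z≤n , near , least) ss y p∣B^y-s
  with nearMultiple⇒∣ {b} {p} {suc n} near
... | η , ηη , p∣B^n-η = ℕ∣.divides q (trans y≡r+q*n (cong (ℕ._+ q ℕ.* suc n) r≡0))
  where
  P = + p
  B = + b
  r = y % suc n
  q = y / suc n
  y≡r+q*n : y ≡ r ℕ.+ q ℕ.* suc n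
  y≡r+q*n = m≡m%n+[m/n]*n y (suc n)
  B^y≡ : B ^ y ≡ B ^ r * (B ^ suc n) ^ q
  B^y≡ = trans (cong (B ^_) y≡r+q*n) (trans (^-distribˡ-+-* B r (q ℕ.* suc n))
           (cong (B ^ r *_) (trans (cong (B ^_) (ℕₚ.*-comm q (suc n))) (sym (^-*-assoc B (suc n) q)))))
  replace : ∀ X x e s → X * x - s - X * (x - e) ≡ X * e - s
  replace = solve-∀
  P∣B^r*η^q-s : P ∣ℤ B ^ r * η ^ q - s
  P∣B^r*η^q-s = subst (P ∣ℤ_) (replace (B ^ r) ((B ^ suc n) ^ q) (η ^ q) s)
    (ℤ∣.∣m∣n⇒∣m-n (subst (λ z → P ∣ℤ z - s) B^y≡ p∣B^y-s)
      (ℤ∣.∣n⇒∣m*n (B ^ r) (∣m-n⇒∣m^k-n^k {P} {B ^ suc n} {η} p∣B^n-η q)))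
  remainder≡0 : ∀ r → r < suc n → P ∣ℤ B ^ r - s * η ^ q → r ≡ 0
  remainder≡0 zero    _   _ = refl
  remainder≡0 (suc r) r<n p∣ = ⊥-elim (ℕₚ.<⇒≱ r<n
    (least (suc r) (s≤s z≤n) (∣⇒nearMultiple 1<b (*-unit {s} {η ^ q} ss (^-unit ηη q)) r p∣)))
  r≡0 : r ≡ 0
  r≡0 = remainder≡0 r (m%n<n y (suc n)) (∣m*u-n⇒∣m-n*u {P} {B ^ r} {s} {η ^ q} (^-unit ηη q) P∣B^r*η^q-s)

p^[G+K]∣b^y-s⇒p^K∣y : ∀ {b p n g₋ g₊ s} → Prime p → 1 < b → p ∤ b → LeastNear b p n →
  p ^ g₋ ∥ (b ℕ.^ n ∸ 1) → p ^ g₊ ∥ (b ℕ.^ n ℕ.+ 1) → Unit s →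
  ∀ K y → (+ p) ^ (g₋ ⊔ g₊ ℕ.+ K) ∣ℤ (+ b) ^ y - s → p ℕ.^ K ∣ y
p^[G+K]∣b^y-s⇒p^K∣y {b} {p} {n} {g₋} {g₊} {s} p-prime 1<b p∤b least@(_ , near , _) h₋ h₊ ss K y h
  with nearMultiple⇒∣ {b} {p} {n} near | factor-at-max {p} {g₋} {g₊} (1<⇒1≤^ 1<b n) h₋ h₊
... | η , ηη , p∣B^n-η | δ , w , δδ , bⁿ≡δ+P^G*w , p∤w =
  subst (p ℕ.^ K ∣_) (sym y≡n*q)
    (ℕ∣.∣n⇒∣m*n n (lifting-the-exponent± {p} {G} {δ} {w} {s} p-prime lift δδ p∤w ss K q h′))
  where
  G = g₋ ⊔ g₊
  1≤G : 1 ≤ G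
  1≤G = 1≤g₋⊔g₊ {p} {b ℕ.^ n} {η} {g₋} {g₊} (1<⇒1≤^ 1<b n) ηη
          (subst (λ B → + p ∣ℤ B - η) (sym (pos-^ b n)) p∣B^n-η) h₋ h₊
  lift : Liftable p G
  lift = 1≤G , p≢2⊎2≤g₋⊔g₊ {p} {b ℕ.^ n} {g₋} {g₊} (prime∤⇒∤^ p-prime p∤b n) h₋ h₊
  n∣y : n ∣ y
  n∣y = leastNear⇒∣ 1<b least ss y (ℤ∣.∣-trans (m∣m^n (ℕₚ.≤-trans 1≤G (ℕₚ.m≤m+n G K))) h)
  q = ℕ∣._∣_.quotient n∣y
  y≡n*q : y ≡ n ℕ.* q
  y≡n*q = ℕ∣.m∣n⇒n≡m*quotient n∣y
  B^y≡ : (+ b) ^ y ≡ (δ + (+ p) ^ G * w) ^ q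
  B^y≡ = trans (cong ((+ b) ^_) y≡n*q)
           (trans (sym (^-*-assoc (+ b) n q)) (cong (_^ q) (trans (sym (pos-^ b n)) bⁿ≡δ+P^G*w)))
  h′ : (+ p) ^ (G ℕ.+ K) ∣ℤ (δ + (+ p) ^ G * w) ^ q - s
  h′ = subst (λ z → (+ p) ^ (G ℕ.+ K) ∣ℤ z - s) B^y≡ h

∣±1⇒∣ℤ : ∀ {k m} → 1 ≤ m → k ∣ m ℕ.+ 1 ⊎ k ∣ m ∸ 1 → Σ ℤ λ s → Unit s × + k ∣ℤ + m - s
∣±1⇒∣ℤ {m = suc m} _ (inj₁ k∣m+1) = -1ℤ , refl , ℤ∣.∣ᵤ⇒∣ k∣m+1
∣±1⇒∣ℤ {m = suc m} _ (inj₂ k∣m∸1) = 1ℤ , refl , ℤ∣.∣ᵤ⇒∣ k∣m∸1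

p^E∣b^y±1⇒p^[E∸G]∣y : ∀ {b p n g₋ g₊} → Prime p → 1 < b → p ∤ b → LeastNear b p n →
  p ^ g₋ ∥ (b ℕ.^ n ∸ 1) → p ^ g₊ ∥ (b ℕ.^ n ℕ.+ 1) →
  ∀ E y → p ℕ.^ E ∣ b ℕ.^ y ℕ.+ 1 ⊎ p ℕ.^ E ∣ b ℕ.^ y ∸ 1 → p ℕ.^ (E ∸ (g₋ ⊔ g₊)) ∣ y
p^E∣b^y±1⇒p^[E∸G]∣y {b} {p} {n} {g₋} {g₊} p-prime 1<b p∤b least h₋ h₊ E y p^E∣b^y±1
  with ∣±1⇒∣ℤ (1<⇒1≤^ 1<b y) p^E∣b^y±1 | ℕₚ.≤-total E (g₋ ⊔ g₊)
... | _ | inj₁ E≤G rewrite ℕₚ.m≤n⇒m∸n≡0 E≤G = ℕ∣.1∣ y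
... | s , ss , p^E∣b^y-s | inj₂ G≤E =
  p^[G+K]∣b^y-s⇒p^K∣y {b} {p} {n} {g₋} {g₊} {s} p-prime 1<b p∤b least h₋ h₊ ss (E ∸ (g₋ ⊔ g₊)) y
    (subst₂ (λ e B → (+ p) ^ e ∣ℤ B - s) (sym (ℕₚ.m+[n∸m]≡n G≤E)) (pos-^ b y)
      (^∣ᵤ⇒^∣ℤ {p} {E} (ℤ∣.∣⇒∣ᵤ p^E∣b^y-s)))

lemma17 : (a b : ℕ) → 1 < a → 1 < b → Coprime a b →
            (x y : ℕ) → (a ℕ.^ x ∣ b ℕ.^ y ℕ.+ 1 ⊎ a ℕ.^ x ∣ b ℕ.^ y ∸ 1) →
            (p : ℕ) → Prime p → p ∣ a →
            (α n g₋ g₊ : ℕ) → p ^ α ∥ a → LeastNear b p n →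
            p ^ g₋ ∥ (b ℕ.^ n ∸ 1) → p ^ g₊ ∥ (b ℕ.^ n ℕ.+ 1) →
            p ℕ.^ (x ℕ.* α ∸ (g₋ ⊔ g₊)) ∣ y
lemma17 a b 1<a 1<b a⊥b x y a^x∣b^y±1 p p-prime p∣a α n g₋ g₊ (p^α∣a , _) least h₋ h₊ =
  p^E∣b^y±1⇒p^[E∸G]∣y {b} {p} {n} {g₋} {g₊} p-prime 1<b p∤b least h₋ h₊ (x ℕ.* α) y
    (⊎-map (ℕ∣.∣-trans p^xα∣a^x) (ℕ∣.∣-trans p^xα∣a^x) a^x∣b^y±1)
  where
  p∤b : p ∤ b
  p∤b p∣b = prime≢1 p-prime (a⊥b (p∣a , p∣b))
  p^xα∣a^x : p ℕ.^ (x ℕ.* α) ∣ a ℕ.^ x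
  p^xα∣a^x = subst (_∣ a ℕ.^ x) (trans (ℕₚ.^-*-assoc p α x) (cong (p ℕ.^_) (ℕₚ.*-comm α x)))
               (^-monoˡ-∣ p^α∣a x)
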